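{- Let $q$ be an odd prime power, fix $\epsilon\in\mathbb{F}_{q^2}\setminus\mathbb{F}_q$ with $\epsilon^q=-\epsilon$, put $\delta=\epsilon^2\in\mathbb{F}_q$, and let $a=a_0+\epsilon a_1\in\mathbb{F}_{q^2}^*$, $b=b_0+\epsilon b_1\in\mathbb{F}_{q^2}\setminus\mathbb{F}_q$ ($a_i,b_i\in\mathbb{F}_q$) with $4a^{q+1}+(b^q-b)^2\neq 0$. Let $\mathcal{B}'$ be the quadric of $\mathrm{PG}(6,q)$ with equation \[ x_0x_6+2a_0(x_1x_2+x_3x_4)+a_1\big(x_1^2+x_3^2+\delta(x_2^2+x_4^2)\big)-b_1\big(x_1^2-\delta x_2^2+x_3^2-\delta x_4^2\big)=0 . \] Then the number of lines of the spread $\mathcal{S}$ (defined in the context) that are entirely contained in $\mathcal{B}'$ is $2q^2+1$ if $q\equiv 1\pmod 4$, and is $1$ if $q\equiv 3\pmod 4$.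
   Context: Points of $\mathrm{PG}(3,q^2)$ have homogeneous coordinates $(J,X,Y,Z)$; $\Sigma_\infty$ is the plane $J=0$. Points of $\mathrm{PG}(6,q)$ have homogeneous coordinates $(x_0,\dots,x_6)$. Every $c\in\mathbb{F}_{q^2}$ is written uniquely as $c=c_0+\epsilon c_1$ with $c_0,c_1\in\mathbb{F}_q$. For a point $P=(0,u,v,w)$ of $\Sigma_\infty$, the spread line $r_P$ is the line of the hyperplane $x_0=0$ of $\mathrm{PG}(6,q)$ consisting of the points $(0,u'_0,u'_1,v'_0,v'_1,w'_0,w'_1)$ where $u'=\lambda u$, $v'=\lambda v$, $w'=\lambda w$ and $\lambda$ ranges over $\mathbb{F}_{q^2}^*$. The set $\mathcal{S}=\{r_P : P\in\Sigma_\infty\}$ is a Desarguesian line spread of the hyperplane $x_0=0$ (this is the Barlotti--Cofman representation of $\mathrm{PG}(3,q^2)$ in $\mathrm{PG}(6,q)$). -}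

module Defs where

open import Level using (0ℓ)
open import Data.Nat as ℕ using (ℕ; zero; suc)
open import Data.Nat.Primality using (Prime)
open import Data.Product using (Σ; ∃; ∃-syntax; _×_; _,_)
open import Data.List using (List; length)
open import Data.List.Relation.Unary.All using (All)
open import Data.List.Relation.Unary.Any using (Any)
open import Data.List.Relation.Unary.AllPairs using (AllPairs)
open import Relation.Nullary using (¬_)
open import Relation.Binary.PropositionalEquality using (_≡_; _≢_)
open import Relation.Binary.Definitions using (DecidableEquality)
open import Algebra.Structures using (IsCommutativeRing)

record FiniteField : Set₁ where
  infixl 6 _+_ _-_
  infixl 7 _*_
  field
    Carrier : Set
    _+_ _*_ : Carrier → Carrier → Carrier
    -_      : Carrier → Carrier
    0# 1#   : Carrier
    isCommutativeRing : IsCommutativeRing _≡_ _+_ _*_ -_ 0# 1#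
    0≢1     : 0# ≢ 1#
    inverse : ∀ x → x ≢ 0# → ∃[ y ] (x * y ≡ 1#)
    _≟_     : DecidableEquality Carrier
    elements : List Carrier
    complete : ∀ x → Any (x ≡_) elements
    distinct : AllPairs _≢_ elements

  order : ℕ
  order = length elements

  _-_ : Carrier → Carrier → Carrier
  x - y = x + (- y)

  2# 4# : Carrier
  2# = 1# + 1#
  4# = 2# + 2#

  IsSquare : Carrier → Set
  IsSquare d = ∃[ y ] (y * y ≡ d)

IsPrimePower : ℕ → Set
IsPrimePower n = ∃[ p ] ∃[ k ] (Prime p × (k ℕ.≥ 1) × (n ≡ p ℕ.^ k))

-- The field F_{q²} = F_q(ε), ε² = δ with δ a non-square of F_q,
-- represented by pairs (c₀ , c₁) meaning c₀ + ε c₁.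
module QuadExt (F : FiniteField) (δ : FiniteField.Carrier F) where
  open FiniteField F

  Ext : Set
  Ext = Carrier × Carrier

  re im : Ext → Carrier
  re (x , _) = x
  im (_ , y) = y

  0ᴱ 1ᴱ εᴱ : Ext
  0ᴱ = 0# , 0#
  1ᴱ = 1# , 0#
  εᴱ = 0# , 1#

  ι : Carrier → Ext
  ι c = c , 0#

  infixl 6 _+ᴱ_ _-ᴱ_
  infixl 7 _*ᴱ_
  infixr 8 _^ᴱ_
  _+ᴱ_ _-ᴱ_ _*ᴱ_ : Ext → Ext → Ext
  (x₀ , x₁) +ᴱ (y₀ , y₁) = (x₀ + y₀) , (x₁ + y₁)
  (x₀ , x₁) -ᴱ (y₀ , y₁) = (x₀ - y₀) , (x₁ - y₁)
  (x₀ , x₁) *ᴱ (y₀ , y₁) = (x₀ * y₀ + δ * (x₁ * y₁)) , (x₀ * y₁ + x₁ * y₀)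

  _^ᴱ_ : Ext → ℕ → Ext
  x ^ᴱ zero = 1ᴱ
  x ^ᴱ suc n = x *ᴱ (x ^ᴱ n)

  NotInBase : Ext → Set
  NotInBase c = im c ≢ 0#

  -- Points of Σ∞: nonzero vectors (u,v,w) ∈ F_{q²}³, up to F_{q²}^* scalars.
  Vec3 : Set
  Vec3 = Ext × Ext × Ext

  NonZero3 : Vec3 → Set
  NonZero3 (u , v , w) = ¬ (u ≡ 0ᴱ × v ≡ 0ᴱ × w ≡ 0ᴱ)

  scale : Ext → Vec3 → Vec3
  scale λ' (u , v , w) = (λ' *ᴱ u) , (λ' *ᴱ v) , (λ' *ᴱ w)

  SamePoint : Vec3 → Vec3 → Set
  SamePoint P P' = ∃[ λ' ] (λ' ≢ 0ᴱ × scale λ' P ≡ P')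

  Q : (a b : Ext) → Carrier → Carrier → Carrier → Carrier → Carrier → Carrier → Carrier → Carrier
  Q a b x₀ x₁ x₂ x₃ x₄ x₅ x₆ =
      x₀ * x₆
    + 2# * re a * (x₁ * x₂ + x₃ * x₄)
    + im a * (x₁ * x₁ + x₃ * x₃ + δ * (x₂ * x₂ + x₄ * x₄))
    - im b * (x₁ * x₁ - δ * (x₂ * x₂) + x₃ * x₃ - δ * (x₄ * x₄))

  -- The spread line r_P is contained in B': every point
  -- (0, u'₀, u'₁, v'₀, v'₁, w'₀, w'₁) with (u',v',w') = λ(u,v,w), λ ≠ 0, lies on B'.
  LineInQuadric : (a b : Ext) → Vec3 → Set
  LineInQuadric a b P = ∀ λ' → λ' ≢ 0ᴱ →
    let (u' , v' , w') = scale λ' P in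
    Q a b 0# (re u') (im u') (re v') (im v') (re w') (im w') ≡ 0#

  -- Exactly n spread lines r_P lie in B': there is a list of n pairwise distinct
  -- points P of Σ∞ whose lines lie in B', and every such point is one of them.
  -- (P ↦ r_P is injective, S being a spread.)
  NumSpreadLinesInQuadric : (a b : Ext) → ℕ → Set
  NumSpreadLinesInQuadric a b n = Σ (List Vec3) λ Ps →
      length Ps ≡ n
    × All NonZero3 Ps
    × All (LineInQuadric a b) Ps
    × AllPairs (λ P P' → ¬ SamePoint P P') Ps
    × (∀ P → NonZero3 P → LineInQuadric a b P → Any (SamePoint P) Ps)

  disc : Ext → Ext → Ext
  disc a b = (ι 4# *ᴱ (a ^ᴱ (order ℕ.+ 1))) +ᴱ (((b ^ᴱ order) -ᴱ b) *ᴱ ((b ^ᴱ order) -ᴱ b))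

-- On the spread line r_P, P = (0, u, v, w), the form of B′ restricts to
-- λ ↦ im(λ² a S) − b₁ N(λ) T, where S = u² + v², T = N(u) + N(v) and N is the
-- norm of F_{q²}/F_q.  Evaluating at λ = 1, ε, 1 + ε shows that (as a ≠ 0 and
-- b₁ ≠ 0) it vanishes for all λ ≠ 0 iff S = 0 and T = 0.  If v = 0 this forces u = 0; otherwise, scaling
-- to v = 1, it forces u = c ∈ F_q with c² = −1.  So the spread lines in B′ are r_P
-- for P = (0, 0, 1) and P = (c, 1, w) with c² = −1 and w ∈ F_{q²} arbitrary:
-- 1 + r q² lines, r the number of square roots of −1 in F_q.  Finally r = 2 iff
-- q ≡ 1 (mod 4): the orbits {x, −x, x⁻¹, −x⁻¹} partition F_q into blocks of
-- size 4, apart from 0, ±1 and the square roots of −1.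
module Submission where

open import Defs
open import Algebra.Bundles using (CommutativeRing)
open import Algebra.Definitions using (Involutive)
open import Algebra.Solver.Ring.AlmostCommutativeRing using (fromCommutativeRing; _-Raw-AlmostCommutative⟶_)
open import Data.Integer as ℤ using (ℤ; -[1+_]; _⊖_)
import Data.Integer.Properties as ℤ
open import Data.List using (List; []; _∷_; _++_; length; map; filter; cartesianProduct)
open import Data.List.Properties using (length-++; length-map)
open import Data.List.Membership.Propositional using (_∈_; lose)
open import Data.List.Membership.Propositional.Properties
  using (∈-filter⁺; ∈-filter⁻; ∈-++⁺ˡ; ∈-++⁺ʳ; ∈-++⁻; ∈-cartesianProduct⁺; ∈-cartesianProduct⁻)
open import Data.List.Membership.Propositional.Properties.WithK using (unique∧set⇒bag)
open import Data.List.Relation.Binary.BagAndSetEquality using (∼bag⇒↭)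
open import Data.List.Relation.Binary.Permutation.Propositional.Properties using (↭-length)
open import Data.List.Relation.Binary.Subset.Propositional using (_⊆_)
open import Data.List.Relation.Unary.All as All using (All; []; _∷_)
import Data.List.Relation.Unary.All.Properties as All
open import Data.List.Relation.Unary.AllPairs as AllPairs using (AllPairs; []; _∷_)
import Data.List.Relation.Unary.AllPairs.Properties as AllPairs
open import Data.List.Relation.Unary.Any as Any using (Any; here; there; any?; satisfied)
import Data.List.Relation.Unary.Any.Properties as Any
open import Data.List.Relation.Unary.Unique.Propositional using (Unique)
import Data.List.Relation.Unary.Unique.Propositional.Properties as Unique
open import Data.Maybe as Maybe using (Maybe)
open import Data.Nat as ℕ using (ℕ; zero; suc; _<_; _%_; s≤s; z≤n)
open import Data.Nat.Divisibility using (_∣_; _∣0; divides; ∣-refl; ∣m∣n⇒∣m+n; n∣m⇒m%n≡0)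
open import Data.Nat.DivMod using ([m+kn]%n≡m%n)
open import Data.Nat.Induction using (<-wellFounded)
import Data.Nat.Properties as ℕ
open import Data.Product using (∃-syntax; _×_; _,_; proj₁; proj₂; uncurry)
open import Data.Product.Properties using (≡-dec)
open import Data.Sum as Sum using (_⊎_; inj₁; inj₂; [_,_]′; reduce)
open import Function using (_∘_; mk⇔)
open import Induction.WellFounded using (Acc; acc)
open import Relation.Binary.Definitions using (DecidableEquality)
open import Relation.Binary.PropositionalEquality
  using (_≡_; _≢_; refl; sym; trans; cong; cong₂; subst; module ≡-Reasoning)
open import Relation.Nullary using (¬_; yes; no; ¬?; contradiction)
open import Relation.Nullary.Decidable using (_×-dec_; dec⇒maybe; toSum)
open import Relation.Unary using (Decidable)

-- The ring solver needs coefficients whose equality can be decided by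
-- computation, so we use ℤ, mapped into the ring by n ↦ n · 1#.
module IntegerCoefficients {c ℓ} (R : CommutativeRing c ℓ) where
  open CommutativeRing R renaming (refl to ≈-refl; sym to ≈-sym; trans to ≈-trans)
  open import Algebra.Properties.Ring ring using (-‿involutive; -‿distribˡ-*; -‿+-comm; -0#≈0#)
  open import Algebra.Properties.Semiring.Mult.TCOptimised semiring using (1+×; ×-homo-+)
    renaming (_×_ to _·_)
  open import Relation.Binary.Reasoning.Setoid setoid

  ⟦_⟧ℤ : ℤ → Carrier
  ⟦ ℤ.+ n ⟧ℤ    = n · 1#
  ⟦ -[1+ n ] ⟧ℤ = - (suc n · 1#)

  [1+x]-[1+y]≈x-y : ∀ x y → (1# + x) - (1# + y) ≈ x - y
  [1+x]-[1+y]≈x-y x y = begin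
    (1# + x) - (1# + y)      ≈⟨ +-congˡ (-‿+-comm 1# y) ⟨
    (1# + x) + (- 1# + - y)  ≈⟨ +-congʳ (+-comm 1# x) ⟩
    (x + 1#) + (- 1# + - y)  ≈⟨ +-assoc x 1# _ ⟩
    x + (1# + (- 1# + - y))  ≈⟨ +-congˡ (+-assoc 1# (- 1#) (- y)) ⟨
    x + ((1# + - 1#) + - y)  ≈⟨ +-congˡ (+-congʳ (-‿inverseʳ 1#)) ⟩
    x + (0# + - y)           ≈⟨ +-congˡ (+-identityˡ (- y)) ⟩
    x - y                    ∎

  ⊖-homo : ∀ m n → ⟦ m ⊖ n ⟧ℤ ≈ m · 1# - n · 1#
  ⊖-homo m zero = begin
    ⟦ m ⊖ 0 ⟧ℤ   ≡⟨ cong ⟦_⟧ℤ (ℤ.⊖-≥ {m} z≤n) ⟩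
    m · 1#        ≈⟨ +-identityʳ (m · 1#) ⟨
    m · 1# + 0#   ≈⟨ +-congˡ -0#≈0# ⟨
    m · 1# - 0#   ∎
  ⊖-homo zero    (suc n) = ≈-sym (+-identityˡ _)
  ⊖-homo (suc m) (suc n) = begin
    ⟦ suc m ⊖ suc n ⟧ℤ              ≡⟨ cong ⟦_⟧ℤ (ℤ.[1+m]⊖[1+n]≡m⊖n m n) ⟩
    ⟦ m ⊖ n ⟧ℤ                     ≈⟨ ⊖-homo m n ⟩
    m · 1# - n · 1#                ≈⟨ [1+x]-[1+y]≈x-y (m · 1#) (n · 1#) ⟨
    (1# + m · 1#) - (1# + n · 1#)  ≈⟨ +-cong (1+× m 1#) (-‿cong (1+× n 1#)) ⟨
    suc m · 1# - suc n · 1#        ∎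

  +-homo : ∀ i j → ⟦ i ℤ.+ j ⟧ℤ ≈ ⟦ i ⟧ℤ + ⟦ j ⟧ℤ
  +-homo (ℤ.+ m)  (ℤ.+ n)  = ×-homo-+ 1# m n
  +-homo (ℤ.+ m)  -[1+ n ] = ⊖-homo m (suc n)
  +-homo -[1+ m ] (ℤ.+ n)  = ≈-trans (⊖-homo n (suc m)) (+-comm _ _)
  +-homo -[1+ m ] -[1+ n ] = begin
    - (suc (suc (m ℕ.+ n)) · 1#)     ≡⟨ cong (λ k → - (k · 1#)) (ℕ.+-suc (suc m) n) ⟨
    - ((suc m ℕ.+ suc n) · 1#)       ≈⟨ -‿cong (×-homo-+ 1# (suc m) (suc n)) ⟩
    - (suc m · 1# + suc n · 1#)      ≈⟨ -‿+-comm _ _ ⟨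
    - (suc m · 1#) + - (suc n · 1#)  ∎

  -‿homo : ∀ i → ⟦ ℤ.- i ⟧ℤ ≈ - ⟦ i ⟧ℤ
  -‿homo (ℤ.+ zero)  = ≈-sym -0#≈0#
  -‿homo (ℤ.+ suc n) = ≈-refl
  -‿homo -[1+ n ]    = ≈-sym (-‿involutive _)

  *-homoᴺ : ∀ m j → ⟦ ℤ.+ m ℤ.* j ⟧ℤ ≈ m · 1# * ⟦ j ⟧ℤ
  *-homoᴺ zero j = begin
    ⟦ ℤ.+ 0 ℤ.* j ⟧ℤ  ≡⟨ cong ⟦_⟧ℤ (ℤ.*-zeroˡ j) ⟩
    0#                ≈⟨ zeroˡ ⟦ j ⟧ℤ ⟨
    0# * ⟦ j ⟧ℤ       ∎
  *-homoᴺ (suc m) j = begin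
    ⟦ ℤ.+ suc m ℤ.* j ⟧ℤ            ≡⟨ cong ⟦_⟧ℤ (ℤ.suc-* (ℤ.+ m) j) ⟩
    ⟦ j ℤ.+ ℤ.+ m ℤ.* j ⟧ℤ          ≈⟨ +-homo j (ℤ.+ m ℤ.* j) ⟩
    ⟦ j ⟧ℤ + ⟦ ℤ.+ m ℤ.* j ⟧ℤ        ≈⟨ +-cong (*-identityˡ _) (≈-sym (*-homoᴺ m j)) ⟨
    1# * ⟦ j ⟧ℤ + m · 1# * ⟦ j ⟧ℤ   ≈⟨ distribʳ ⟦ j ⟧ℤ 1# (m · 1#) ⟨
    (1# + m · 1#) * ⟦ j ⟧ℤ          ≈⟨ *-congʳ (1+× m 1#) ⟨
    suc m · 1# * ⟦ j ⟧ℤ             ∎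

  *-homo : ∀ i j → ⟦ i ℤ.* j ⟧ℤ ≈ ⟦ i ⟧ℤ * ⟦ j ⟧ℤ
  *-homo (ℤ.+ m)  j = *-homoᴺ m j
  *-homo -[1+ m ] j = begin
    ⟦ -[1+ m ] ℤ.* j ⟧ℤ            ≡⟨ cong ⟦_⟧ℤ (ℤ.neg-distribˡ-* (ℤ.+ suc m) j) ⟨
    ⟦ ℤ.- (ℤ.+ suc m ℤ.* j) ⟧ℤ     ≈⟨ -‿homo (ℤ.+ suc m ℤ.* j) ⟩
    - ⟦ ℤ.+ suc m ℤ.* j ⟧ℤ         ≈⟨ -‿cong (*-homoᴺ (suc m) j) ⟩
    - (suc m · 1# * ⟦ j ⟧ℤ)        ≈⟨ -‿distribˡ-* _ _ ⟩
    ⟦ -[1+ m ] ⟧ℤ * ⟦ j ⟧ℤ         ∎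

  ℤ⟶R : ℤ.+-*-rawRing -Raw-AlmostCommutative⟶ fromCommutativeRing R
  ℤ⟶R = record
    { ⟦_⟧ = ⟦_⟧ℤ ; +-homo = +-homo ; *-homo = *-homo ; -‿homo = -‿homo ; 0-homo = ≈-refl ; 1-homo = ≈-refl }

  ⟦⟧ℤ-≟ : ∀ i j → Maybe (⟦ i ⟧ℤ ≈ ⟦ j ⟧ℤ)
  ⟦⟧ℤ-≟ i j = Maybe.map (reflexive ∘ cong ⟦_⟧ℤ) (dec⇒maybe (i ℤ.≟ j))

  open import Algebra.Solver.Ring ℤ.+-*-rawRing (fromCommutativeRing R) ℤ⟶R ⟦⟧ℤ-≟ public

module _ {A : Set} where

  unique∧set⇒length≡ : ∀ {xs ys : List A} → Unique xs → Unique ys →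
                        (∀ {z} → z ∈ xs → z ∈ ys) → (∀ {z} → z ∈ ys → z ∈ xs) →
                        length xs ≡ length ys
  unique∧set⇒length≡ xs! ys! xs⊆ys ys⊆xs = ↭-length (∼bag⇒↭ (unique∧set⇒bag xs! ys! (mk⇔ xs⊆ys ys⊆xs)))

  length-cartesianProduct : ∀ {B : Set} (xs : List A) (ys : List B) →
                            length (cartesianProduct xs ys) ≡ length xs ℕ.* length ys
  length-cartesianProduct []       ys = refl
  length-cartesianProduct (x ∷ xs) ys = trans (length-++ (Data.List.map (x ,_) ys))
    (cong₂ ℕ._+_ (length-map (x ,_) ys) (length-cartesianProduct xs ys))

module BlockCounting {A : Set} (_≟_ : DecidableEquality A) (block : A → List A) where
  open import Data.List.Membership.DecPropositional _≟_ using (_∈?_)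

  record BlockPartition (k : ℕ) (xs : List A) : Set where
    field
      block-unique : ∀ {x} → x ∈ xs → Unique (block x)
      block-length : ∀ {x} → x ∈ xs → length (block x) ≡ k
      block-⊆      : ∀ {x} → x ∈ xs → block x ⊆ xs
      block-refl   : ∀ {x} → x ∈ xs → x ∈ block x
      block-sym    : ∀ {x y} → x ∈ xs → y ∈ block x → x ∈ block y
      block-trans  : ∀ {x y} → x ∈ xs → y ∈ block x → block y ⊆ block x

  restrict : ∀ {k xs ys} → BlockPartition k xs → ys ⊆ xs → (∀ {y} → y ∈ ys → block y ⊆ ys) →
             BlockPartition k ys
  restrict P ys⊆xs ys-closed = record
    { block-unique = block-unique ∘ ys⊆xs
    ; block-length = block-length ∘ ys⊆xs
    ; block-⊆      = ys-closed
    ; block-refl   = block-refl ∘ ys⊆xs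
    ; block-sym    = block-sym ∘ ys⊆xs
    ; block-trans  = block-trans ∘ ys⊆xs
    }
    where open BlockPartition P

  module RemoveBlock {k xs} (xs! : Unique xs) (P : BlockPartition k xs) {x} (x∈ : x ∈ xs) where
    open BlockPartition P

    ∉block? : Decidable (λ y → ¬ y ∈ block x)
    ∉block? y = ¬? (y ∈? block x)

    rest : List A
    rest = filter ∉block? xs

    rest! : Unique rest
    rest! = Unique.filter⁺ ∉block? xs!

    ∈rest⁻ : ∀ {y} → y ∈ rest → y ∈ xs × ¬ y ∈ block x
    ∈rest⁻ = ∈-filter⁻ ∉block? {xs = xs}

    rest-partition : BlockPartition k rest
    rest-partition = restrict P (proj₁ ∘ ∈rest⁻) λ y∈rest z∈By →
      let y∈ , y∉Bx = ∈rest⁻ y∈rest in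
      ∈-filter⁺ ∉block? (block-⊆ y∈ z∈By) (λ z∈Bx → y∉Bx (block-trans x∈ z∈Bx (block-sym y∈ z∈By)))

    length≡k+rest : length xs ≡ k ℕ.+ length rest
    length≡k+rest = begin
      length xs                         ≡⟨ unique∧set⇒length≡ xs! block++rest! split block++rest⊆xs ⟩
      length (block x ++ rest)          ≡⟨ length-++ (block x) ⟩
      length (block x) ℕ.+ length rest  ≡⟨ cong (ℕ._+ length rest) (block-length x∈) ⟩
      k ℕ.+ length rest                 ∎
      where
      open ≡-Reasoning
      block++rest⊆xs : block x ++ rest ⊆ xs
      block++rest⊆xs = [ block-⊆ x∈ , proj₁ ∘ ∈rest⁻ ]′ ∘ ∈-++⁻ (block x)
      block++rest! : Unique (block x ++ rest)
      block++rest! = Unique.++⁺ (block-unique x∈) rest! (λ (z∈B , z∈rest) → proj₂ (∈rest⁻ z∈rest) z∈B)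
      split : ∀ {z} → z ∈ xs → z ∈ block x ++ rest
      split {z} z∈ with z ∈? block x
      ... | yes z∈B = ∈-++⁺ˡ z∈B
      ... | no  z∉B = ∈-++⁺ʳ (block x) (∈-filter⁺ ∉block? z∈ z∉B)

    0<k : 0 < k
    0<k = subst (0 <_) (block-length x∈) (nonempty (block-refl x∈))
      where
      nonempty : ∀ {ys : List A} → x ∈ ys → 0 < length ys
      nonempty (here _)  = s≤s z≤n
      nonempty (there _) = s≤s z≤n

  ∣length : ∀ {k xs} → Unique xs → BlockPartition k xs → k ∣ length xs
  ∣length {k} {xs} = go xs (<-wellFounded (length xs))
    where
    go : ∀ xs → Acc _<_ (length xs) → Unique xs → BlockPartition k xs → k ∣ length xs
    go []       _         _   _ = k ∣0
    go (x ∷ xs) (acc rec) xs! P =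
      subst (k ∣_) (sym length≡k+rest) (∣m∣n⇒∣m+n ∣-refl (go rest (rec rest<) rest! rest-partition))
      where
      open RemoveBlock xs! P (here refl)
      rest< : length rest < length (x ∷ xs)
      rest< = subst (length rest <_) (sym length≡k+rest) (ℕ.m<n+m (length rest) 0<k)

module InvolutionOrbits {A : Set} (σ : A → A) (σ-involutive : Involutive _≡_ σ) where

  orbit : A → List A
  orbit x = x ∷ σ x ∷ []

  orbit-sym : ∀ {x y} → y ∈ orbit x → x ∈ orbit y
  orbit-sym     (here refl)         = here refl
  orbit-sym {x} (there (here refl)) = there (here (sym (σ-involutive x)))

  orbit-trans : ∀ {x y} → y ∈ orbit x → orbit y ⊆ orbit x
  orbit-trans y∈              (here refl)         = y∈
  orbit-trans (here refl)     (there z∈)          = there z∈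
  orbit-trans {x} (there (here refl)) (there (here refl)) = here (σ-involutive x)

module KleinOrbits {A : Set} (σ τ : A → A)
  (σ-involutive : Involutive _≡_ σ) (τ-involutive : Involutive _≡_ τ)
  (σ∘τ≡τ∘σ : ∀ x → σ (τ x) ≡ τ (σ x)) where

  orbit : A → List A
  orbit x = x ∷ σ x ∷ τ x ∷ σ (τ x) ∷ []

  τ∘σ∘τ≡σ : ∀ x → τ (σ (τ x)) ≡ σ x
  τ∘σ∘τ≡σ x = trans (sym (σ∘τ≡τ∘σ (τ x))) (cong σ (τ-involutive x))

  orbit-σ : ∀ {x y} → y ∈ orbit x → σ y ∈ orbit x
  orbit-σ     (here refl)                         = there (here refl)
  orbit-σ {x} (there (here refl))                 = here (σ-involutive x)
  orbit-σ     (there (there (here refl)))         = there (there (there (here refl)))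
  orbit-σ {x} (there (there (there (here refl)))) = there (there (here (σ-involutive (τ x))))

  orbit-τ : ∀ {x y} → y ∈ orbit x → τ y ∈ orbit x
  orbit-τ     (here refl)                         = there (there (here refl))
  orbit-τ {x} (there (here refl))                 = there (there (there (here (sym (σ∘τ≡τ∘σ x)))))
  orbit-τ {x} (there (there (here refl)))         = here (τ-involutive x)
  orbit-τ {x} (there (there (there (here refl)))) = there (here (τ∘σ∘τ≡σ x))

  orbit-sym : ∀ {x y} → y ∈ orbit x → x ∈ orbit y
  orbit-sym     (here refl)                         = here refl
  orbit-sym {x} (there (here refl))                 = there (here (sym (σ-involutive x)))
  orbit-sym {x} (there (there (here refl)))         = there (there (here (sym (τ-involutive x))))
  orbit-sym {x} (there (there (there (here refl)))) =
    there (there (there (here (sym (trans (cong σ (τ∘σ∘τ≡σ x)) (σ-involutive x))))))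

  orbit-trans : ∀ {x y} → y ∈ orbit x → orbit y ⊆ orbit x
  orbit-trans y∈ (here refl)                         = y∈
  orbit-trans y∈ (there (here refl))                 = orbit-σ y∈
  orbit-trans y∈ (there (there (here refl)))         = orbit-τ y∈
  orbit-trans y∈ (there (there (there (here refl)))) = orbit-σ (orbit-τ y∈)

module FieldProperties (F : FiniteField) where
  open FiniteField F

  commutativeRing : CommutativeRing _ _
  commutativeRing = record { isCommutativeRing = isCommutativeRing }

  open CommutativeRing commutativeRing public
    using (+-identityˡ; +-identityʳ; *-identityˡ; *-identityʳ; zeroˡ; zeroʳ; -‿inverseˡ; -‿inverseʳ; *-comm)
  open import Algebra.Properties.Ring (CommutativeRing.ring commutativeRing) public
    using (-‿involutive; -0#≈0#; -‿injective)
  open IntegerCoefficients commutativeRing public using (solve; _:=_; con; _:+_; _:*_; _:-_; :-_; Polynomial)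

  0ᴾ 1ᴾ 2ᴾ : ∀ {n} → Polynomial n
  0ᴾ = con (ℤ.+ 0)
  1ᴾ = con (ℤ.+ 1)
  2ᴾ = con (ℤ.+ 2)

  1≢0 : 1# ≢ 0#
  1≢0 = 0≢1 ∘ sym

  x-y≡0⇒x≡y : ∀ {x y} → x - y ≡ 0# → x ≡ y
  x-y≡0⇒x≡y {x} {y} x-y≡0 = begin
    x              ≡⟨ solve 2 (λ x y → x := (x :- y) :+ y) refl x y ⟩
    (x - y) + y    ≡⟨ cong (_+ y) x-y≡0 ⟩
    0# + y         ≡⟨ +-identityˡ y ⟩
    y              ∎
    where open ≡-Reasoning

  x+y≡0⇒x≡-y : ∀ {x y} → x + y ≡ 0# → x ≡ - y
  x+y≡0⇒x≡-y {x} {y} x+y≡0 = x-y≡0⇒x≡y (trans (cong (λ t → x + t) (-‿involutive y)) x+y≡0)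

  -- 0# ⁻¹ = 0#, which makes -_ and _⁻¹ commuting involutions of the whole field.
  _⁻¹ : Carrier → Carrier
  x ⁻¹ with x ≟ 0#
  ... | yes _   = 0#
  ... | no  x≢0 = proj₁ (inverse x x≢0)

  ⁻¹-inverseʳ : ∀ {x} → x ≢ 0# → x * x ⁻¹ ≡ 1#
  ⁻¹-inverseʳ {x} x≢0 with x ≟ 0#
  ... | yes x≡0 = contradiction x≡0 x≢0
  ... | no  x≢0 = proj₂ (inverse x x≢0)

  *-cancelˡ-≡0 : ∀ {x y} → x ≢ 0# → x * y ≡ 0# → y ≡ 0#
  *-cancelˡ-≡0 {x} {y} x≢0 xy≡0 = begin
    y                  ≡⟨ *-identityˡ y ⟨
    1# * y             ≡⟨ cong (_* y) (⁻¹-inverseʳ x≢0) ⟨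
    (x * x ⁻¹) * y     ≡⟨ solve 3 (λ x i y → (x :* i) :* y := i :* (x :* y)) refl x (x ⁻¹) y ⟩
    x ⁻¹ * (x * y)     ≡⟨ cong (x ⁻¹ *_) xy≡0 ⟩
    x ⁻¹ * 0#          ≡⟨ zeroʳ (x ⁻¹) ⟩
    0#                 ∎
    where open ≡-Reasoning

  zero-product : ∀ {x y} → x * y ≡ 0# → x ≡ 0# ⊎ y ≡ 0#
  zero-product {x} xy≡0 with x ≟ 0#
  ... | yes x≡0 = inj₁ x≡0
  ... | no  x≢0 = inj₂ (*-cancelˡ-≡0 x≢0 xy≡0)

  *-≢0 : ∀ {x y} → x ≢ 0# → y ≢ 0# → x * y ≢ 0#
  *-≢0 x≢0 y≢0 = [ x≢0 , y≢0 ]′ ∘ zero-product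

  x*x≡0⇒x≡0 : ∀ {x} → x * x ≡ 0# → x ≡ 0#
  x*x≡0⇒x≡0 = reduce ∘ zero-product

  square-roots : ∀ {x y} → x * x ≡ y * y → x ≡ y ⊎ x ≡ - y
  square-roots {x} {y} x²≡y² = Sum.map x-y≡0⇒x≡y x+y≡0⇒x≡-y (zero-product (begin
    (x - y) * (x + y)  ≡⟨ solve 2 (λ x y → (x :- y) :* (x :+ y) := x :* x :- y :* y) refl x y ⟩
    x * x - y * y      ≡⟨ cong (λ t → t - y * y) x²≡y² ⟩
    y * y - y * y      ≡⟨ -‿inverseʳ (y * y) ⟩
    0#                 ∎))
    where open ≡-Reasoning

  -‿≢0 : ∀ {x} → x ≢ 0# → - x ≢ 0#
  -‿≢0 {x} x≢0 -x≡0 = x≢0 (-‿injective (trans -x≡0 (sym -0#≈0#)))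

  ⁻¹-≢0 : ∀ {x} → x ≢ 0# → x ⁻¹ ≢ 0#
  ⁻¹-≢0 {x} x≢0 x⁻¹≡0 = 1≢0 (trans (sym (⁻¹-inverseʳ x≢0)) (trans (cong (x *_) x⁻¹≡0) (zeroʳ x)))

  ⁻¹-zero : ∀ {x} → x ≡ 0# → x ⁻¹ ≡ 0#
  ⁻¹-zero {x} x≡0 with x ≟ 0#
  ... | yes _   = refl
  ... | no  x≢0 = contradiction x≡0 x≢0

  inverse-unique : ∀ {x y z} → x * y ≡ 1# → x * z ≡ 1# → y ≡ z
  inverse-unique {x} {y} {z} xy≡1 xz≡1 = begin
    y              ≡⟨ *-identityʳ y ⟨
    y * 1#         ≡⟨ cong (y *_) xz≡1 ⟨
    y * (x * z)    ≡⟨ solve 3 (λ x y z → y :* (x :* z) := (x :* y) :* z) refl x y z ⟩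
    (x * y) * z    ≡⟨ cong (_* z) xy≡1 ⟩
    1# * z         ≡⟨ *-identityˡ z ⟩
    z              ∎
    where open ≡-Reasoning

  ⁻¹-involutive : Involutive _≡_ _⁻¹
  ⁻¹-involutive x with toSum (x ≟ 0#)
  ... | inj₁ x≡0 = trans (⁻¹-zero (⁻¹-zero x≡0)) (sym x≡0)
  ... | inj₂ x≢0 = inverse-unique (⁻¹-inverseʳ (⁻¹-≢0 x≢0)) (trans (*-comm (x ⁻¹) x) (⁻¹-inverseʳ x≢0))

  -‿⁻¹-comm : ∀ x → - (x ⁻¹) ≡ (- x) ⁻¹
  -‿⁻¹-comm x with toSum (x ≟ 0#)
  ... | inj₁ x≡0 = begin
    - (x ⁻¹)    ≡⟨ cong -_ (⁻¹-zero x≡0) ⟩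
    - 0#        ≡⟨ -0#≈0# ⟩
    0#          ≡⟨ ⁻¹-zero (trans (cong -_ x≡0) -0#≈0#) ⟨
    (- x) ⁻¹    ∎
    where open ≡-Reasoning
  ... | inj₂ x≢0 = inverse-unique (trans (solve 2 (λ x i → (:- x) :* (:- i) := x :* i) refl x (x ⁻¹)) (⁻¹-inverseʳ x≢0))
                                  (⁻¹-inverseʳ (-‿≢0 x≢0))

  record SquareRoots (d : Carrier) (rs : List Carrier) : Set where
    field
      unique   : Unique rs
      sound    : ∀ {r} → r ∈ rs → r * r ≡ d
      complete : ∀ {r} → r * r ≡ d → r ∈ rs

  module OddCharacteristic (2≢0 : 2# ≢ 0#) where

    x≢-x : ∀ {x} → x ≢ 0# → x ≢ - x
    x≢-x {x} x≢0 x≡-x = x≢0 (*-cancelˡ-≡0 2≢0 (begin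
      2# * x        ≡⟨ solve 1 (λ x → 2ᴾ :* x := x :+ x) refl x ⟩
      x + x         ≡⟨ cong (x +_) x≡-x ⟩
      x - x         ≡⟨ -‿inverseʳ x ⟩
      0#            ∎))
      where open ≡-Reasoning

    -x*-x≡x*x : ∀ x → - x * - x ≡ x * x
    -x*-x≡x*x = solve 1 (λ x → (:- x) :* (:- x) := x :* x) refl

    ±-squareRoots : ∀ {r d} → d ≢ 0# → r * r ≡ d → SquareRoots d (r ∷ - r ∷ [])
    ±-squareRoots {r} {d} d≢0 r²≡d = record
      { unique   = (x≢-x r≢0 ∷ []) ∷ [] ∷ []
      ; sound    = λ { (here refl) → r²≡d ; (there (here refl)) → trans (-x*-x≡x*x r) r²≡d }
      ; complete = λ s²≡d → [ here , there ∘ here ]′ (square-roots (trans s²≡d (sym r²≡d)))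
      }
      where
      r≢0 : r ≢ 0#
      r≢0 r≡0 = d≢0 (trans (sym r²≡d) (trans (cong (_* r) r≡0) (zeroˡ r)))

    squareRoots : ∀ d → d ≢ 0# → SquareRoots d [] ⊎ ∃[ r ] SquareRoots d (r ∷ - r ∷ [])
    squareRoots d d≢0 with any? (λ r → (r * r) ≟ d) elements
    ... | yes ∃r = inj₂ (_ , ±-squareRoots d≢0 (proj₂ (satisfied ∃r)))
    ... | no  ∄r = inj₁ (record
      { unique   = []
      ; sound    = λ ()
      ; complete = λ {r} r²≡d → contradiction (lose (complete r) r²≡d) ∄r
      })

module Characteristic (F : FiniteField) where
  open FiniteField F
  open FieldProperties F

  2≢0 : order % 2 ≡ 1 → 2# ≢ 0#
  2≢0 q-odd 2≡0 = ℕ.0≢1+n (trans (sym (n∣m⇒m%n≡0 order 2 2∣order)) q-odd)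
    where
    +1-involutive : Involutive _≡_ (_+ 1#)
    +1-involutive x = begin
      (x + 1#) + 1#  ≡⟨ solve 1 (λ x → (x :+ 1ᴾ) :+ 1ᴾ := x :+ 2ᴾ) refl x ⟩
      x + 2#         ≡⟨ cong (x +_) 2≡0 ⟩
      x + 0#         ≡⟨ +-identityʳ x ⟩
      x              ∎
      where open ≡-Reasoning
    x≢x+1 : ∀ x → x ≢ x + 1#
    x≢x+1 x x≡x+1 = 0≢1 (begin
      0#              ≡⟨ -‿inverseˡ x ⟨
      - x + x         ≡⟨ cong (- x +_) x≡x+1 ⟩
      - x + (x + 1#)  ≡⟨ solve 1 (λ x → :- x :+ (x :+ 1ᴾ) := 1ᴾ) refl x ⟩
      1#              ∎)
      where open ≡-Reasoning
    open InvolutionOrbits (_+ 1#) +1-involutive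
    open BlockCounting _≟_ orbit
    partition : BlockPartition 2 elements
    partition = record
      { block-unique = λ {x} _ → (x≢x+1 x ∷ []) ∷ [] ∷ []
      ; block-length = λ _ → refl
      ; block-⊆      = λ _ _ → complete _
      ; block-refl   = λ _ → here refl
      ; block-sym    = λ _ → orbit-sym
      ; block-trans  = λ _ → orbit-trans
      }
    2∣order : 2 ∣ order
    2∣order = ∣length distinct partition

module KleinCount (F : FiniteField) (2≢0 : FiniteField.2# F ≢ FiniteField.0# F) where
  open FiniteField F
  open FieldProperties F
  open OddCharacteristic 2≢0

  HasFreeOrbit : Carrier → Set
  HasFreeOrbit x = x ≢ 0# × x * x ≢ 1# × x * x ≢ - 1#

  hasFreeOrbit? : Decidable HasFreeOrbit
  hasFreeOrbit? x = ¬? (x ≟ 0#) ×-dec ¬? ((x * x) ≟ 1#) ×-dec ¬? ((x * x) ≟ (- 1#))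

  -1*-1≡1 : - 1# * - 1# ≡ 1#
  -1*-1≡1 = trans (-x*-x≡x*x 1#) (*-identityˡ 1#)

  ≡c*x⁻¹⇒x*x≡c : ∀ {x c} → x ≢ 0# → x ≡ c * x ⁻¹ → x * x ≡ c
  ≡c*x⁻¹⇒x*x≡c {x} {c} x≢0 x≡cx⁻¹ = begin
    x * x              ≡⟨ cong (x *_) x≡cx⁻¹ ⟩
    x * (c * x ⁻¹)     ≡⟨ solve 3 (λ x c i → x :* (c :* i) := c :* (x :* i)) refl x c (x ⁻¹) ⟩
    c * (x * x ⁻¹)     ≡⟨ cong (c *_) (⁻¹-inverseʳ x≢0) ⟩
    c * 1#             ≡⟨ *-identityʳ c ⟩
    c                  ∎
    where open ≡-Reasoning

  ⁻¹*⁻¹≡c⇒*≡c : ∀ {x c} → x ≢ 0# → c * c ≡ 1# → x ⁻¹ * x ⁻¹ ≡ c → x * x ≡ c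
  ⁻¹*⁻¹≡c⇒*≡c {x} {c} x≢0 c²≡1 x⁻²≡c = inverse-unique (begin
    c * (x * x)                    ≡⟨ cong (_* (x * x)) x⁻²≡c ⟨
    (x ⁻¹ * x ⁻¹) * (x * x)        ≡⟨ solve 2 (λ x i → (i :* i) :* (x :* x) := (x :* i) :* (x :* i)) refl x (x ⁻¹) ⟩
    (x * x ⁻¹) * (x * x ⁻¹)        ≡⟨ cong₂ _*_ (⁻¹-inverseʳ x≢0) (⁻¹-inverseʳ x≢0) ⟩
    1# * 1#                        ≡⟨ *-identityˡ 1# ⟩
    1#                             ∎) c²≡1
    where open ≡-Reasoning

  hasFreeOrbit-neg : ∀ {x} → HasFreeOrbit x → HasFreeOrbit (- x)
  hasFreeOrbit-neg {x} (x≢0 , x²≢1 , x²≢-1) =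
    -‿≢0 x≢0 , x²≢1 ∘ trans (sym (-x*-x≡x*x x)) , x²≢-1 ∘ trans (sym (-x*-x≡x*x x))

  hasFreeOrbit-⁻¹ : ∀ {x} → HasFreeOrbit x → HasFreeOrbit (x ⁻¹)
  hasFreeOrbit-⁻¹ (x≢0 , x²≢1 , x²≢-1) =
    ⁻¹-≢0 x≢0 , x²≢1 ∘ ⁻¹*⁻¹≡c⇒*≡c x≢0 (*-identityˡ 1#) , x²≢-1 ∘ ⁻¹*⁻¹≡c⇒*≡c x≢0 -1*-1≡1

  open KleinOrbits -_ _⁻¹ -‿involutive ⁻¹-involutive -‿⁻¹-comm

  orbit-hasFreeOrbit : ∀ {x y} → HasFreeOrbit x → y ∈ orbit x → HasFreeOrbit y
  orbit-hasFreeOrbit fx (here refl)                         = fx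
  orbit-hasFreeOrbit fx (there (here refl))                 = hasFreeOrbit-neg fx
  orbit-hasFreeOrbit fx (there (there (here refl)))         = hasFreeOrbit-⁻¹ fx
  orbit-hasFreeOrbit fx (there (there (there (here refl)))) = hasFreeOrbit-neg (hasFreeOrbit-⁻¹ fx)

  orbit-unique : ∀ {x} → HasFreeOrbit x → Unique (orbit x)
  orbit-unique {x} (x≢0 , x²≢1 , x²≢-1) =
      (x≢-x x≢0 ∷ x≢x⁻¹ ∷ x≢-x⁻¹ ∷ [])
    ∷ (-x≢x⁻¹ ∷ x≢x⁻¹ ∘ -‿injective ∷ [])
    ∷ (x≢-x (⁻¹-≢0 x≢0) ∷ [])
    ∷ [] ∷ []
    where
    x≢x⁻¹ : x ≢ x ⁻¹
    x≢x⁻¹ = x²≢1 ∘ ≡c*x⁻¹⇒x*x≡c x≢0 ∘ (λ e → trans e (sym (*-identityˡ (x ⁻¹))))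
    x≢-x⁻¹ : x ≢ - (x ⁻¹)
    x≢-x⁻¹ = x²≢-1 ∘ ≡c*x⁻¹⇒x*x≡c x≢0 ∘ (λ e → trans e (solve 1 (λ i → :- i := (:- 1ᴾ) :* i) refl (x ⁻¹)))
    -x≢x⁻¹ : - x ≢ x ⁻¹
    -x≢x⁻¹ -x≡x⁻¹ = x≢-x⁻¹ (trans (sym (-‿involutive x)) (cong -_ -x≡x⁻¹))

  open BlockCounting _≟_ orbit

  freeOrbits : List Carrier
  freeOrbits = filter hasFreeOrbit? elements

  freeOrbits-unique : Unique freeOrbits
  freeOrbits-unique = Unique.filter⁺ hasFreeOrbit? {elements} distinct

  ∈freeOrbits⇒hasFreeOrbit : ∀ {x} → x ∈ freeOrbits → HasFreeOrbit x
  ∈freeOrbits⇒hasFreeOrbit = proj₂ ∘ ∈-filter⁻ hasFreeOrbit? {xs = elements}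

  freeOrbits-partition : BlockPartition 4 freeOrbits
  freeOrbits-partition = record
    { block-unique = orbit-unique ∘ ∈freeOrbits⇒hasFreeOrbit
    ; block-length = λ _ → refl
    ; block-⊆      = λ x∈ {y} y∈ →
        ∈-filter⁺ hasFreeOrbit? (complete y) (orbit-hasFreeOrbit (∈freeOrbits⇒hasFreeOrbit x∈) y∈)
    ; block-refl   = λ _ → here refl
    ; block-sym    = λ _ → orbit-sym
    ; block-trans  = λ _ → orbit-trans
    }

  module Special {ps ms} (√1 : SquareRoots 1# ps) (√-1 : SquareRoots (- 1#) ms) where
    module √1 = SquareRoots √1
    module √-1 = SquareRoots √-1

    special : List Carrier
    special = 0# ∷ ps ++ ms

    special-sound : ∀ {z} → z ∈ special → z ≡ 0# ⊎ z * z ≡ 1# ⊎ z * z ≡ - 1#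
    special-sound (here z≡0) = inj₁ z≡0
    special-sound (there z∈) = inj₂ (Sum.map √1.sound √-1.sound (∈-++⁻ ps z∈))

    special-unique : Unique special
    special-unique = All.tabulate 0∉ ∷ Unique.++⁺ √1.unique √-1.unique
      (λ (z∈ps , z∈ms) → x≢-x 1≢0 (trans (sym (√1.sound z∈ps)) (√-1.sound z∈ms)))
      where
      0∉ : ∀ {z} → z ∈ ps ++ ms → 0# ≢ z
      0∉ z∈ refl with ∈-++⁻ ps z∈
      ... | inj₁ 0∈ps = 0≢1 (trans (sym (zeroˡ 0#)) (√1.sound 0∈ps))
      ... | inj₂ 0∈ms = -‿≢0 1≢0 (sym (trans (sym (zeroˡ 0#)) (√-1.sound 0∈ms)))

    order≡#free+#special : order ≡ length freeOrbits ℕ.+ length special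
    order≡#free+#special = trans
      (unique∧set⇒length≡ distinct (Unique.++⁺ freeOrbits-unique special-unique disjoint) split (λ {z} _ → complete z))
      (length-++ freeOrbits)
      where
      disjoint : ∀ {z} → ¬ (z ∈ freeOrbits × z ∈ special)
      disjoint (z∈free , z∈special) = let (z≢0 , z²≢1 , z²≢-1) = ∈freeOrbits⇒hasFreeOrbit z∈free in
        [ z≢0 , [ z²≢1 , z²≢-1 ]′ ]′ (special-sound z∈special)
      split : ∀ {z} → z ∈ elements → z ∈ freeOrbits ++ special
      split {z} z∈ with z ≟ 0# | (z * z) ≟ 1# | (z * z) ≟ (- 1#)
      ... | yes z≡0 | _        | _         = ∈-++⁺ʳ freeOrbits (here z≡0)
      ... | no _    | yes z²≡1 | _         = ∈-++⁺ʳ freeOrbits (there (∈-++⁺ˡ (√1.complete z²≡1)))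
      ... | no _    | no _     | yes z²≡-1 = ∈-++⁺ʳ freeOrbits (there (∈-++⁺ʳ ps (√-1.complete z²≡-1)))
      ... | no z≢0  | no z²≢1  | no z²≢-1  = ∈-++⁺ˡ (∈-filter⁺ hasFreeOrbit? z∈ (z≢0 , z²≢1 , z²≢-1))

  order-mod-4 : ∀ {ps ms} → SquareRoots 1# ps → SquareRoots (- 1#) ms →
                order % 4 ≡ length (0# ∷ ps ++ ms) % 4
  order-mod-4 √1 √-1 with ∣length freeOrbits-unique freeOrbits-partition
  ... | divides m #free≡m*4 = begin
    order % 4                                   ≡⟨ cong (_% 4) order≡#free+#special ⟩
    (length freeOrbits ℕ.+ length special) % 4  ≡⟨ cong (λ n → (n ℕ.+ length special) % 4) #free≡m*4 ⟩
    (m ℕ.* 4 ℕ.+ length special) % 4            ≡⟨ cong (_% 4) (ℕ.+-comm (m ℕ.* 4) (length special)) ⟩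
    (length special ℕ.+ m ℕ.* 4) % 4            ≡⟨ [m+kn]%n≡m%n (length special) m 4 ⟩
    length special % 4                          ∎
    where
    open ≡-Reasoning
    open Special √1 √-1

module QuadraticExtension (F : FiniteField) {δ : FiniteField.Carrier F}
                          (δ-nonsquare : ¬ FiniteField.IsSquare F δ) where
  open FiniteField F
  open FieldProperties F
  open QuadExt F δ

  -- Ext arithmetic on solver expressions, so that solved identities unfold to Ext operations.
  module ExtSyntax {n} (d : Polynomial n) where
    infixl 7 _*ᴾ_
    infixl 6 _+ᴾ_
    _*ᴾ_ _+ᴾ_ : Polynomial n × Polynomial n → Polynomial n × Polynomial n → Polynomial n × Polynomial n
    (x₀ , x₁) *ᴾ (y₀ , y₁) = (x₀ :* y₀ :+ d :* (x₁ :* y₁)) , (x₀ :* y₁ :+ x₁ :* y₀)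
    (x₀ , x₁) +ᴾ (y₀ , y₁) = (x₀ :+ y₀) , (x₁ :+ y₁)
    Nᴾ : Polynomial n × Polynomial n → Polynomial n
    Nᴾ (x₀ , x₁) = x₀ :* x₀ :- d :* (x₁ :* x₁)

  δ≢0 : δ ≢ 0#
  δ≢0 δ≡0 = δ-nonsquare (0# , trans (zeroˡ 0#) (sym δ≡0))

  N : Ext → Carrier
  N (x₀ , x₁) = x₀ * x₀ - δ * (x₁ * x₁)

  N≡0⇒≡0ᴱ : ∀ {x} → N x ≡ 0# → x ≡ 0ᴱ
  N≡0⇒≡0ᴱ {x₀ , x₁} Nx≡0 with toSum (x₁ ≟ 0#)
  ... | inj₁ refl = cong (_, 0#) (x*x≡0⇒x≡0
    (trans (solve 2 (λ x d → x :* x := x :* x :- d :* (0ᴾ :* 0ᴾ)) refl x₀ δ) Nx≡0))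
  ... | inj₂ x₁≢0 = contradiction (x₀ * x₁ ⁻¹ , x₀/x₁²≡δ) δ-nonsquare
    where
    open ≡-Reasoning
    x₀/x₁²≡δ : (x₀ * x₁ ⁻¹) * (x₀ * x₁ ⁻¹) ≡ δ
    x₀/x₁²≡δ = begin
      (x₀ * x₁ ⁻¹) * (x₀ * x₁ ⁻¹)
        ≡⟨ solve 2 (λ x i → (x :* i) :* (x :* i) := (x :* x) :* (i :* i)) refl x₀ (x₁ ⁻¹) ⟩
      (x₀ * x₀) * (x₁ ⁻¹ * x₁ ⁻¹)
        ≡⟨ cong (_* (x₁ ⁻¹ * x₁ ⁻¹)) (x-y≡0⇒x≡y Nx≡0) ⟩
      (δ * (x₁ * x₁)) * (x₁ ⁻¹ * x₁ ⁻¹)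
        ≡⟨ solve 3 (λ d x i → (d :* (x :* x)) :* (i :* i) := d :* ((x :* i) :* (x :* i))) refl δ x₁ (x₁ ⁻¹) ⟩
      δ * ((x₁ * x₁ ⁻¹) * (x₁ * x₁ ⁻¹)) ≡⟨ cong (λ t → δ * (t * t)) (⁻¹-inverseʳ x₁≢0) ⟩
      δ * (1# * 1#)                     ≡⟨ cong (δ *_) (*-identityˡ 1#) ⟩
      δ * 1#                            ≡⟨ *-identityʳ δ ⟩
      δ                                 ∎

  N-*ᴱ : ∀ x y → N (x *ᴱ y) ≡ N x * N y
  N-*ᴱ (x₀ , x₁) (y₀ , y₁) = solve 5 (λ x₀ x₁ y₀ y₁ d → let open ExtSyntax d in
    Nᴾ ((x₀ , x₁) *ᴾ (y₀ , y₁)) := Nᴾ (x₀ , x₁) :* Nᴾ (y₀ , y₁)) refl x₀ x₁ y₀ y₁ δ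

  N0ᴱ≡0 : N 0ᴱ ≡ 0#
  N0ᴱ≡0 = solve 1 (λ d → 0ᴾ :* 0ᴾ :- d :* (0ᴾ :* 0ᴾ) := 0ᴾ) refl δ

  1ᴱ≢0ᴱ : 1ᴱ ≢ 0ᴱ
  1ᴱ≢0ᴱ = 1≢0 ∘ cong re

  *ᴱ-zeroˡ : ∀ x → 0ᴱ *ᴱ x ≡ 0ᴱ
  *ᴱ-zeroˡ (x₀ , x₁) = cong₂ _,_
    (solve 3 (λ x₀ x₁ d → 0ᴾ :* x₀ :+ d :* (0ᴾ :* x₁) := 0ᴾ) refl x₀ x₁ δ)
    (solve 2 (λ x₀ x₁ → 0ᴾ :* x₁ :+ 0ᴾ :* x₀ := 0ᴾ) refl x₀ x₁)

  *ᴱ-zeroʳ : ∀ x → x *ᴱ 0ᴱ ≡ 0ᴱ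
  *ᴱ-zeroʳ (x₀ , x₁) = cong₂ _,_
    (solve 3 (λ x₀ x₁ d → x₀ :* 0ᴾ :+ d :* (x₁ :* 0ᴾ) := 0ᴾ) refl x₀ x₁ δ)
    (solve 2 (λ x₀ x₁ → x₀ :* 0ᴾ :+ x₁ :* 0ᴾ := 0ᴾ) refl x₀ x₁)

  *ᴱ-identityˡ : ∀ x → 1ᴱ *ᴱ x ≡ x
  *ᴱ-identityˡ (x₀ , x₁) = cong₂ _,_
    (solve 3 (λ x₀ x₁ d → 1ᴾ :* x₀ :+ d :* (0ᴾ :* x₁) := x₀) refl x₀ x₁ δ)
    (solve 2 (λ x₀ x₁ → 1ᴾ :* x₁ :+ 0ᴾ :* x₀ := x₁) refl x₀ x₁)

  *ᴱ-identityʳ : ∀ x → x *ᴱ 1ᴱ ≡ x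
  *ᴱ-identityʳ (x₀ , x₁) = cong₂ _,_
    (solve 3 (λ x₀ x₁ d → x₀ :* 1ᴾ :+ d :* (x₁ :* 0ᴾ) := x₀) refl x₀ x₁ δ)
    (solve 2 (λ x₀ x₁ → x₀ :* 0ᴾ :+ x₁ :* 1ᴾ := x₁) refl x₀ x₁)

  ≢0ᴱ⇒N≢0 : ∀ {x} → x ≢ 0ᴱ → N x ≢ 0#
  ≢0ᴱ⇒N≢0 x≢0 = x≢0 ∘ N≡0⇒≡0ᴱ

  *ᴱ-cancelˡ-≡0ᴱ : ∀ {x y} → x ≢ 0ᴱ → x *ᴱ y ≡ 0ᴱ → y ≡ 0ᴱ
  *ᴱ-cancelˡ-≡0ᴱ {x} {y} x≢0 xy≡0 = N≡0⇒≡0ᴱ (*-cancelˡ-≡0 (≢0ᴱ⇒N≢0 x≢0) (begin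
    N x * N y       ≡⟨ N-*ᴱ x y ⟨
    N (x *ᴱ y)      ≡⟨ cong N xy≡0 ⟩
    N 0ᴱ            ≡⟨ N0ᴱ≡0 ⟩
    0#              ∎))
    where open ≡-Reasoning

  _⁻¹ᴱ : Ext → Ext
  x@(x₀ , x₁) ⁻¹ᴱ = x₀ * N x ⁻¹ , - x₁ * N x ⁻¹

  ⁻¹ᴱ-inverseˡ : ∀ {x} → x ≢ 0ᴱ → x ⁻¹ᴱ *ᴱ x ≡ 1ᴱ
  ⁻¹ᴱ-inverseˡ {x@(x₀ , x₁)} x≢0 = cong₂ _,_
    (trans (solve 4 (λ x₀ x₁ n d → (x₀ :* n) :* x₀ :+ d :* (((:- x₁) :* n) :* x₁) := (x₀ :* x₀ :- d :* (x₁ :* x₁)) :* n)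
                    refl x₀ x₁ (N x ⁻¹) δ)
           (⁻¹-inverseʳ (≢0ᴱ⇒N≢0 x≢0)))
    (solve 3 (λ x₀ x₁ n → (x₀ :* n) :* x₁ :+ ((:- x₁) :* n) :* x₀ := 0ᴾ) refl x₀ x₁ (N x ⁻¹))

  ⁻¹ᴱ-≢0ᴱ : ∀ {x} → x ≢ 0ᴱ → x ⁻¹ᴱ ≢ 0ᴱ
  ⁻¹ᴱ-≢0ᴱ {x} x≢0 x⁻¹≡0 = 1ᴱ≢0ᴱ (begin
    1ᴱ             ≡⟨ ⁻¹ᴱ-inverseˡ x≢0 ⟨
    x ⁻¹ᴱ *ᴱ x     ≡⟨ cong (_*ᴱ x) x⁻¹≡0 ⟩
    0ᴱ *ᴱ x        ≡⟨ *ᴱ-zeroˡ x ⟩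
    0ᴱ             ∎)
    where open ≡-Reasoning

  im[λ²z]≡Nλ*t⇒≡0 : 2# ≢ 0# → ∀ {z t} → (∀ λ′ → λ′ ≢ 0ᴱ → im ((λ′ *ᴱ λ′) *ᴱ z) - N λ′ * t ≡ 0#) →
                    z ≡ 0ᴱ × t ≡ 0#
  im[λ²z]≡Nλ*t⇒≡0 2≢0 {z₀ , z₁} {t} vanishes = cong₂ _,_ z₀≡0 z₁≡0 , t≡0
    where
    open ≡-Reasoning
    at1 : z₁ - t ≡ 0#
    at1 = trans (solve 4 (λ z₀ z₁ t d → let open ExtSyntax d in
                   z₁ :- t := proj₂ (((1ᴾ , 0ᴾ) *ᴾ (1ᴾ , 0ᴾ)) *ᴾ (z₀ , z₁)) :- Nᴾ (1ᴾ , 0ᴾ) :* t) refl z₀ z₁ t δ)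
                (vanishes 1ᴱ 1ᴱ≢0ᴱ)
    atε : δ * (z₁ + t) ≡ 0#
    atε = trans (solve 4 (λ z₀ z₁ t d → let open ExtSyntax d in
                   d :* (z₁ :+ t) := proj₂ (((0ᴾ , 1ᴾ) *ᴾ (0ᴾ , 1ᴾ)) *ᴾ (z₀ , z₁)) :- Nᴾ (0ᴾ , 1ᴾ) :* t) refl z₀ z₁ t δ)
                (vanishes εᴱ (1≢0 ∘ cong im))
    t≡0 : t ≡ 0#
    t≡0 = *-cancelˡ-≡0 2≢0 (begin
      2# * t                 ≡⟨ solve 2 (λ z₁ t → 2ᴾ :* t := (z₁ :+ t) :- (z₁ :- t)) refl z₁ t ⟩
      (z₁ + t) - (z₁ - t)    ≡⟨ cong₂ _-_ (*-cancelˡ-≡0 δ≢0 atε) at1 ⟩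
      0# - 0#                ≡⟨ -‿inverseʳ 0# ⟩
      0#                     ∎)
    z₁≡0 : z₁ ≡ 0#
    z₁≡0 = trans (x-y≡0⇒x≡y at1) t≡0
    z₀≡0 : z₀ ≡ 0#
    z₀≡0 = *-cancelˡ-≡0 2≢0 (begin
      2# * z₀
        ≡⟨ solve 2 (λ z₀ d → let open ExtSyntax d in
             2ᴾ :* z₀ := proj₂ (((1ᴾ , 1ᴾ) *ᴾ (1ᴾ , 1ᴾ)) *ᴾ (z₀ , 0ᴾ)) :- Nᴾ (1ᴾ , 1ᴾ) :* 0ᴾ) refl z₀ δ ⟩
      im (((1# , 1#) *ᴱ (1# , 1#)) *ᴱ (z₀ , 0#)) - N (1# , 1#) * 0#
        ≡⟨ cong₂ (λ z₁ t → im (((1# , 1#) *ᴱ (1# , 1#)) *ᴱ (z₀ , z₁)) - N (1# , 1#) * t) z₁≡0 t≡0 ⟨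
      im (((1# , 1#) *ᴱ (1# , 1#)) *ᴱ (z₀ , z₁)) - N (1# , 1#) * t
        ≡⟨ vanishes (1# , 1#) (1≢0 ∘ cong re) ⟩
      0# ∎)

module SpreadLines (F : FiniteField) {δ : FiniteField.Carrier F} (δ-nonsquare : ¬ FiniteField.IsSquare F δ)
                   (2≢0 : FiniteField.2# F ≢ FiniteField.0# F)
                   (a b : QuadExt.Ext F δ) (a≢0ᴱ : a ≢ QuadExt.0ᴱ F δ) (b∉Fq : QuadExt.NotInBase F δ b) where
  open FiniteField F
  open FieldProperties F
  open QuadExt F δ
  open QuadraticExtension F δ-nonsquare

  Q₀ : Vec3 → Carrier
  Q₀ (u , v , w) = Q a b 0# (re u) (im u) (re v) (im v) (re w) (im w)

  S : Vec3 → Ext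
  S (u , v , _) = u *ᴱ u +ᴱ v *ᴱ v

  T : Vec3 → Carrier
  T (u , v , _) = N u + N v

  Q₀≡ : ∀ P → Q₀ P ≡ im (a *ᴱ S P) - im b * T P
  Q₀≡ ((p , q) , (r , s) , (_ , w₁)) = solve 9 (λ a₀ a₁ b₁ d p q r s w₁ → let open ExtSyntax d in
       0ᴾ :* w₁ :+ 2ᴾ :* a₀ :* (p :* q :+ r :* s)
    :+ a₁ :* (p :* p :+ r :* r :+ d :* (q :* q :+ s :* s))
    :- b₁ :* (p :* p :- d :* (q :* q) :+ r :* r :- d :* (s :* s))
    := proj₂ ((a₀ , a₁) *ᴾ ((p , q) *ᴾ (p , q) +ᴾ (r , s) *ᴾ (r , s))) :- b₁ :* (Nᴾ (p , q) :+ Nᴾ (r , s)))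
    refl (re a) (im a) (im b) δ p q r s w₁

  S-scale : ∀ λ′ P → S (scale λ′ P) ≡ (λ′ *ᴱ λ′) *ᴱ S P
  S-scale (l₀ , l₁) ((p , q) , (r , s) , _) = cong₂ _,_
    (solve 7 (λ l₀ l₁ p q r s d → proj₁ (lhs d l₀ l₁ p q r s) := proj₁ (rhs d l₀ l₁ p q r s)) refl l₀ l₁ p q r s δ)
    (solve 7 (λ l₀ l₁ p q r s d → proj₂ (lhs d l₀ l₁ p q r s) := proj₂ (rhs d l₀ l₁ p q r s)) refl l₀ l₁ p q r s δ)
    where
    lhs rhs : ∀ {n} (d l₀ l₁ p q r s : Polynomial n) → Polynomial n × Polynomial n
    lhs d l₀ l₁ p q r s = let open ExtSyntax d; l = (l₀ , l₁) in
      (l *ᴾ (p , q)) *ᴾ (l *ᴾ (p , q)) +ᴾ (l *ᴾ (r , s)) *ᴾ (l *ᴾ (r , s))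
    rhs d l₀ l₁ p q r s = let open ExtSyntax d; l = (l₀ , l₁) in
      (l *ᴾ l) *ᴾ ((p , q) *ᴾ (p , q) +ᴾ (r , s) *ᴾ (r , s))

  T-scale : ∀ λ′ P → T (scale λ′ P) ≡ N λ′ * T P
  T-scale (l₀ , l₁) ((p , q) , (r , s) , _) = solve 7 (λ l₀ l₁ p q r s d → let open ExtSyntax d in
      Nᴾ ((l₀ , l₁) *ᴾ (p , q)) :+ Nᴾ ((l₀ , l₁) *ᴾ (r , s)) := Nᴾ (l₀ , l₁) :* (Nᴾ (p , q) :+ Nᴾ (r , s)))
    refl l₀ l₁ p q r s δ

  Q₀-scale : ∀ λ′ P → Q₀ (scale λ′ P) ≡ im ((λ′ *ᴱ λ′) *ᴱ (a *ᴱ S P)) - N λ′ * (im b * T P)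
  Q₀-scale λ′ P = begin
    Q₀ (scale λ′ P)
      ≡⟨ Q₀≡ (scale λ′ P) ⟩
    im (a *ᴱ S (scale λ′ P)) - im b * T (scale λ′ P)
      ≡⟨ cong₂ (λ s t → im (a *ᴱ s) - im b * t) (S-scale λ′ P) (T-scale λ′ P) ⟩
    im (a *ᴱ ((λ′ *ᴱ λ′) *ᴱ S P)) - im b * (N λ′ * T P)
      ≡⟨ swap a (λ′ *ᴱ λ′) (S P) (N λ′) (im b) (T P) ⟩
    im ((λ′ *ᴱ λ′) *ᴱ (a *ᴱ S P)) - N λ′ * (im b * T P)
      ∎
    where
    open ≡-Reasoning
    swap : ∀ x y z m n t → im (x *ᴱ (y *ᴱ z)) - n * (m * t) ≡ im (y *ᴱ (x *ᴱ z)) - m * (n * t)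
    swap (x₀ , x₁) (y₀ , y₁) (z₀ , z₁) m n t = solve 10 (λ x₀ x₁ y₀ y₁ z₀ z₁ m n t d → let open ExtSyntax d in
        proj₂ ((x₀ , x₁) *ᴾ ((y₀ , y₁) *ᴾ (z₀ , z₁))) :- n :* (m :* t)
     := proj₂ ((y₀ , y₁) *ᴾ ((x₀ , x₁) *ᴾ (z₀ , z₁))) :- m :* (n :* t)) refl x₀ x₁ y₀ y₁ z₀ z₁ m n t δ

  lineInQuadric⇒ : ∀ {P} → LineInQuadric a b P → S P ≡ 0ᴱ × T P ≡ 0#
  lineInQuadric⇒ {P} P⊆B′ =
    let aS≡0 , b₁T≡0 = im[λ²z]≡Nλ*t⇒≡0 2≢0 (λ λ′ λ′≢0 → trans (sym (Q₀-scale λ′ P)) (P⊆B′ λ′ λ′≢0))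
    in *ᴱ-cancelˡ-≡0ᴱ a≢0ᴱ aS≡0 , *-cancelˡ-≡0 b∉Fq b₁T≡0

  lineInQuadric⇐ : ∀ {P} → S P ≡ 0ᴱ → T P ≡ 0# → LineInQuadric a b P
  lineInQuadric⇐ {P} S≡0 T≡0 λ′ _ = begin
    Q₀ (scale λ′ P)
      ≡⟨ Q₀-scale λ′ P ⟩
    im ((λ′ *ᴱ λ′) *ᴱ (a *ᴱ S P)) - N λ′ * (im b * T P)
      ≡⟨ cong₂ (λ s t → im ((λ′ *ᴱ λ′) *ᴱ (a *ᴱ s)) - N λ′ * (im b * t)) S≡0 T≡0 ⟩
    im ((λ′ *ᴱ λ′) *ᴱ (a *ᴱ 0ᴱ)) - N λ′ * (im b * 0#)
      ≡⟨ cong₂ (λ z t → im ((λ′ *ᴱ λ′) *ᴱ z) - N λ′ * t) (*ᴱ-zeroʳ a) (zeroʳ (im b)) ⟩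
    im ((λ′ *ᴱ λ′) *ᴱ 0ᴱ) - N λ′ * 0#
      ≡⟨ cong₂ (λ z t → im z - t) (*ᴱ-zeroʳ (λ′ *ᴱ λ′)) (zeroʳ (N λ′)) ⟩
    0# - 0#
      ≡⟨ -‿inverseʳ 0# ⟩
    0#
      ∎
    where open ≡-Reasoning

  P₀ : Vec3
  P₀ = 0ᴱ , 0ᴱ , 1ᴱ

  point : Carrier → Ext → Vec3
  point c w = ι c , 1ᴱ , w

  S≡0∧T≡0⇒ : ∀ {u v w} → S (u , v , w) ≡ 0ᴱ → T (u , v , w) ≡ 0# →
             re u * re u ≡ - (re v * re v) × im u * im u ≡ - (im v * im v)
  S≡0∧T≡0⇒ {p , q} {r , s} S≡0 T≡0 =
      x+y≡0⇒x≡-y (*-cancelˡ-≡0 2≢0 (begin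
        2# * (p * p + r * r)       ≡⟨ solve 5 (λ p q r s d → let open ExtSyntax d in
                                        2ᴾ :* (p :* p :+ r :* r)
                                     := proj₁ ((p , q) *ᴾ (p , q) +ᴾ (r , s) *ᴾ (r , s)) :+ (Nᴾ (p , q) :+ Nᴾ (r , s)))
                                     refl p q r s δ ⟩
        re (S P) + T P             ≡⟨ cong₂ _+_ (cong re S≡0) T≡0 ⟩
        0# + 0#                    ≡⟨ +-identityˡ 0# ⟩
        0#                         ∎))
    , x+y≡0⇒x≡-y (*-cancelˡ-≡0 (*-≢0 2≢0 δ≢0) (begin
        (2# * δ) * (q * q + s * s) ≡⟨ solve 5 (λ p q r s d → let open ExtSyntax d in
                                        (2ᴾ :* d) :* (q :* q :+ s :* s)
                                     := proj₁ ((p , q) *ᴾ (p , q) +ᴾ (r , s) *ᴾ (r , s)) :- (Nᴾ (p , q) :+ Nᴾ (r , s)))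
                                     refl p q r s δ ⟩
        re (S P) - T P             ≡⟨ cong₂ _-_ (cong re S≡0) T≡0 ⟩
        0# - 0#                    ≡⟨ -‿inverseʳ 0# ⟩
        0#                         ∎))
    where
    open ≡-Reasoning
    P : Vec3
    P = (p , q) , (r , s) , 0ᴱ

  -0*0≡0 : - (0# * 0#) ≡ 0#
  -0*0≡0 = trans (cong -_ (zeroˡ 0#)) -0#≈0#

  classify : ∀ {P} → NonZero3 P → S P ≡ 0ᴱ → T P ≡ 0# →
             SamePoint P P₀ ⊎ ∃[ c ] (c * c ≡ - 1# × ∃[ w ] SamePoint P (point c w))
  classify {P@(u , v , w)} P≢0 S≡0 T≡0 with ≡-dec _≟_ _≟_ v 0ᴱ
  ... | yes refl = inj₁ (w ⁻¹ᴱ , ⁻¹ᴱ-≢0ᴱ w≢0 , cong₂ _,_ w⁻¹u≡0 (cong₂ _,_ (*ᴱ-zeroʳ (w ⁻¹ᴱ)) (⁻¹ᴱ-inverseˡ w≢0)))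
    where
    u≡0 : u ≡ 0ᴱ
    u≡0 = let u₀²≡-0² , u₁²≡-0² = S≡0∧T≡0⇒ {u} {0ᴱ} {w} S≡0 T≡0 in
      cong₂ _,_ (x*x≡0⇒x≡0 (trans u₀²≡-0² -0*0≡0)) (x*x≡0⇒x≡0 (trans u₁²≡-0² -0*0≡0))
    w≢0 : w ≢ 0ᴱ
    w≢0 w≡0 = P≢0 (u≡0 , refl , w≡0)
    w⁻¹u≡0 : w ⁻¹ᴱ *ᴱ u ≡ 0ᴱ
    w⁻¹u≡0 = trans (cong (w ⁻¹ᴱ *ᴱ_) u≡0) (*ᴱ-zeroʳ (w ⁻¹ᴱ))
  ... | no v≢0 = inj₂ (re u′ , c²≡-1 , λ′ *ᴱ w , λ′ , ⁻¹ᴱ-≢0ᴱ v≢0 , λ′P≡point)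
    where
    λ′ u′ : Ext
    λ′ = v ⁻¹ᴱ
    u′ = λ′ *ᴱ u
    P′ : Vec3
    P′ = u′ , 1ᴱ , λ′ *ᴱ w
    λ′P≡P′ : scale λ′ P ≡ P′
    λ′P≡P′ = cong (λ v′ → u′ , v′ , λ′ *ᴱ w) (⁻¹ᴱ-inverseˡ v≢0)
    S[P′]≡0 : S P′ ≡ 0ᴱ
    S[P′]≡0 = trans (cong S (sym λ′P≡P′)) (trans (S-scale λ′ P) (trans (cong ((λ′ *ᴱ λ′) *ᴱ_) S≡0) (*ᴱ-zeroʳ _)))
    T[P′]≡0 : T P′ ≡ 0#
    T[P′]≡0 = trans (cong T (sym λ′P≡P′)) (trans (T-scale λ′ P) (trans (cong (N λ′ *_) T≡0) (zeroʳ (N λ′))))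
    c²≡-1 : re u′ * re u′ ≡ - 1#
    c²≡-1 = trans (proj₁ (S≡0∧T≡0⇒ {u′} {1ᴱ} {λ′ *ᴱ w} S[P′]≡0 T[P′]≡0)) (cong -_ (*-identityˡ 1#))
    u′₁≡0 : im u′ ≡ 0#
    u′₁≡0 = x*x≡0⇒x≡0 (trans (proj₂ (S≡0∧T≡0⇒ {u′} {1ᴱ} {λ′ *ᴱ w} S[P′]≡0 T[P′]≡0)) -0*0≡0)
    λ′P≡point : scale λ′ P ≡ point (re u′) (λ′ *ᴱ w)
    λ′P≡point = trans λ′P≡P′ (cong (λ x → (re u′ , x) , 1ᴱ , λ′ *ᴱ w) u′₁≡0)

  P₀⊆B′ : LineInQuadric a b P₀
  P₀⊆B′ = lineInQuadric⇐ {P₀}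
    (trans (cong₂ _+ᴱ_ (*ᴱ-zeroʳ 0ᴱ) (*ᴱ-zeroʳ 0ᴱ)) (cong₂ _,_ (+-identityˡ 0#) (+-identityˡ 0#)))
    (trans (cong₂ _+_ N0ᴱ≡0 N0ᴱ≡0) (+-identityˡ 0#))

  S-point : ∀ c w → S (point c w) ≡ ι (c * c + 1#)
  S-point c w = cong₂ _,_
    (solve 2 (λ c d → (c :* c :+ d :* (0ᴾ :* 0ᴾ)) :+ (1ᴾ :* 1ᴾ :+ d :* (0ᴾ :* 0ᴾ)) := c :* c :+ 1ᴾ) refl c δ)
    (solve 1 (λ c → (c :* 0ᴾ :+ 0ᴾ :* c) :+ (1ᴾ :* 0ᴾ :+ 0ᴾ :* 1ᴾ) := 0ᴾ) refl c)

  T-point : ∀ c w → T (point c w) ≡ c * c + 1#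
  T-point c w = solve 2 (λ c d → (c :* c :- d :* (0ᴾ :* 0ᴾ)) :+ (1ᴾ :* 1ᴾ :- d :* (0ᴾ :* 0ᴾ)) := c :* c :+ 1ᴾ) refl c δ

  point⊆B′ : ∀ {c} w → c * c ≡ - 1# → LineInQuadric a b (point c w)
  point⊆B′ {c} w c²≡-1 = lineInQuadric⇐ {point c w} (trans (S-point c w) (cong ι c²+1≡0)) (trans (T-point c w) c²+1≡0)
    where
    c²+1≡0 : c * c + 1# ≡ 0#
    c²+1≡0 = trans (cong (_+ 1#) c²≡-1) (-‿inverseˡ 1#)

  P₀≁point : ∀ {c w} → ¬ SamePoint P₀ (point c w)
  P₀≁point (λ′ , _ , λ′P₀≡point) = 1ᴱ≢0ᴱ (trans (sym (cong (proj₁ ∘ proj₂) λ′P₀≡point)) (*ᴱ-zeroʳ λ′))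

  point-injective : ∀ {c c′ w w′} → SamePoint (point c w) (point c′ w′) → c ≡ c′ × w ≡ w′
  point-injective {c} {c′} {w} {w′} (λ′ , _ , λ′P≡P′) =
      cong re (trans (sym (*ᴱ-identityˡ (ι c))) (trans (cong (_*ᴱ ι c) (sym λ′≡1)) (cong proj₁ λ′P≡P′)))
    , trans (sym (*ᴱ-identityˡ w)) (trans (cong (_*ᴱ w) (sym λ′≡1)) (cong (proj₂ ∘ proj₂) λ′P≡P′))
    where
    λ′≡1 : λ′ ≡ 1ᴱ
    λ′≡1 = trans (sym (*ᴱ-identityʳ λ′)) (cong (proj₁ ∘ proj₂) λ′P≡P′)

  allExt : List Ext
  allExt = cartesianProduct elements elements

  module _ {cs} (√-1 : SquareRoots (- 1#) cs) where
    module √-1 = SquareRoots √-1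

    pairs : List (Carrier × Ext)
    pairs = cartesianProduct cs allExt

    points : List Vec3
    points = map (uncurry point) pairs

    #lines : length (P₀ ∷ points) ≡ length cs ℕ.* (order ℕ.* order) ℕ.+ 1
    #lines = begin
      suc (length points)                     ≡⟨ cong suc (length-map (uncurry point) pairs) ⟩
      suc (length pairs)                      ≡⟨ cong suc (length-cartesianProduct cs allExt) ⟩
      suc (length cs ℕ.* length allExt)       ≡⟨ cong (λ n → suc (length cs ℕ.* n)) (length-cartesianProduct elements elements) ⟩
      suc (length cs ℕ.* (order ℕ.* order))   ≡⟨ ℕ.+-comm 1 _ ⟩
      length cs ℕ.* (order ℕ.* order) ℕ.+ 1   ∎
      where open ≡-Reasoning

    nonZero : All NonZero3 (P₀ ∷ points)
    nonZero = (1ᴱ≢0ᴱ ∘ proj₂ ∘ proj₂) ∷ All.map⁺ (All.tabulate (λ _ → 1ᴱ≢0ᴱ ∘ proj₁ ∘ proj₂))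

    pairs⊆B′ : ∀ {cw} → cw ∈ pairs → LineInQuadric a b (uncurry point cw)
    pairs⊆B′ {c , w} cw∈ = point⊆B′ w (√-1.sound (proj₁ (∈-cartesianProduct⁻ cs allExt cw∈)))

    ⊆B′ : All (LineInQuadric a b) (P₀ ∷ points)
    ⊆B′ = P₀⊆B′ ∷ All.map⁺ (All.tabulate pairs⊆B′)

    pairs-distinct : AllPairs (λ cw c′w′ → ¬ SamePoint (uncurry point cw) (uncurry point c′w′)) pairs
    pairs-distinct = AllPairs.map (λ cw≢c′w′ → cw≢c′w′ ∘ uncurry (cong₂ _,_) ∘ point-injective)
                                  (Unique.cartesianProduct⁺ √-1.unique (Unique.cartesianProduct⁺ distinct distinct))

    distinct-points : AllPairs (λ P P′ → ¬ SamePoint P P′) (P₀ ∷ points)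
    distinct-points = All.map⁺ (All.tabulate (λ _ → P₀≁point)) ∷ AllPairs.map⁺ pairs-distinct

    complete-lines : ∀ P → NonZero3 P → LineInQuadric a b P → Any (SamePoint P) (P₀ ∷ points)
    complete-lines P P≢0 P⊆B′ = [ here , there ∘ ∈points ]′ (classify P≢0 (proj₁ S≡0∧T≡0) (proj₂ S≡0∧T≡0))
      where
      S≡0∧T≡0 : S P ≡ 0ᴱ × T P ≡ 0#
      S≡0∧T≡0 = lineInQuadric⇒ P⊆B′
      ∈points : ∃[ c ] (c * c ≡ - 1# × ∃[ w ] SamePoint P (point c w)) → Any (SamePoint P) points
      ∈points (c , c²≡-1 , w , P~point) = Any.map⁺ (lose cw∈pairs P~point)
        where
        cw∈pairs : (c , w) ∈ pairs
        cw∈pairs = ∈-cartesianProduct⁺ (√-1.complete c²≡-1) (∈-cartesianProduct⁺ (complete (re w)) (complete (im w)))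

    numSpreadLinesInQuadric : NumSpreadLinesInQuadric a b (length cs ℕ.* (order ℕ.* order) ℕ.+ 1)
    numSpreadLinesInQuadric = P₀ ∷ points , #lines , nonZero , ⊆B′ , distinct-points , complete-lines

open import Data.Nat using (_+_; _*_)
open FiniteField using (Carrier; order; IsSquare)
open QuadExt using (Ext; 0ᴱ; NotInBase; disc; NumSpreadLinesInQuadric)

proposition5p1 : (F : FiniteField) →
    IsPrimePower (order F) → order F % 2 ≡ 1 →
    (δ : Carrier F) → ¬ IsSquare F δ →
    (a b : Ext F δ) → a ≢ 0ᴱ F δ → NotInBase F δ b →
    disc F δ a b ≢ 0ᴱ F δ →
    (order F % 4 ≡ 1 → NumSpreadLinesInQuadric F δ a b (2 * (order F * order F) + 1))
    × (order F % 4 ≡ 3 → NumSpreadLinesInQuadric F δ a b 1)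
proposition5p1 F _ q-odd δ δ-nonsquare a b a≢0ᴱ b∉Fq _ = byRootsOf-1 (squareRoots (- 1#) (-‿≢0 1≢0))
  where
  open FiniteField F using (1#; -_; 2#; 0#)
  open FieldProperties F using (1≢0; -‿≢0; *-identityˡ; SquareRoots; module OddCharacteristic)

  2≢0 : 2# ≢ 0#
  2≢0 = Characteristic.2≢0 F q-odd

  open OddCharacteristic 2≢0 using (±-squareRoots; squareRoots)
  open KleinCount F 2≢0 using (order-mod-4)
  open SpreadLines F δ-nonsquare 2≢0 a b a≢0ᴱ b∉Fq using (numSpreadLinesInQuadric)

  √1 : SquareRoots 1# (1# ∷ - 1# ∷ [])
  √1 = ±-squareRoots 1≢0 (*-identityˡ 1#)

  byRootsOf-1 : SquareRoots (- 1#) [] ⊎ ∃[ i ] SquareRoots (- 1#) (i ∷ - i ∷ []) →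
                (order F % 4 ≡ 1 → NumSpreadLinesInQuadric F δ a b (2 * (order F * order F) + 1))
                × (order F % 4 ≡ 3 → NumSpreadLinesInQuadric F δ a b 1)
  byRootsOf-1 (inj₁ none)    = (λ q%4≡1 → contradiction (trans (sym q%4≡1) (order-mod-4 √1 none)) λ ())
                             , (λ _ → numSpreadLinesInQuadric none)
  byRootsOf-1 (inj₂ (i , ±i)) = (λ _ → numSpreadLinesInQuadric ±i)
                             , (λ q%4≡3 → contradiction (trans (sym q%4≡3) (order-mod-4 √1 ±i)) λ ())
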